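{- Let $U\subseteq\mathbb N$ be open in the Kirch topology, let $n\in\mathbb N$, and let $p$ be a prime. Suppose there is some $u\in U$ with $u\equiv n\pmod p$. Then for every $k\in\mathbb N$ there are infinitely many $u\in U$ with $u\equiv n\pmod{p^k}$.
   Context: $\mathbb N=\{1,2,\dots\}$, $\mathbb N_0=\{0,1,2,\dots\}$. The Kirch topology on $\mathbb N$ is the topology with basis all arithmetic progressions $a+d\mathbb N_0$ with $a,d\in\mathbb N$, $\gcd(a,d)=1$ and $d$ square-free. -}

module Defs where

open import Data.Nat using (ℕ; _+_; _*_; _≤_; _<_; _^_)
open import Data.Nat.Base using (∣_-_∣)
open import Data.Nat.Divisibility using (_∣_)
open import Data.Nat.Coprimality using (Coprime)
open import Data.Product using (Σ; _×_; ∃)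

-- Subsets of ℕ as predicates; only elements ≥ 1 matter (the space is ℕ = {1,2,…}).

_≡_[mod_] : ℕ → ℕ → ℕ → Set
a ≡ b [mod m ] = m ∣ ∣ a - b ∣

SquareFree : ℕ → Set
SquareFree d = ∀ (q : ℕ) → 2 ≤ q → q * q ∣ d → Data.Empty.⊥
  where import Data.Empty

InAP : ℕ → ℕ → ℕ → Set
InAP a d x = ∃ λ (t : ℕ) → x ≡ a + d * t
  where open import Relation.Binary.PropositionalEquality using (_≡_)

IsKirchBasic : ℕ → ℕ → Set
IsKirchBasic a d = (1 ≤ a) × (1 ≤ d) × Coprime a d × SquareFree d

KirchOpen : (ℕ → Set) → Set
KirchOpen U = ∀ (u : ℕ) → 1 ≤ u → U u →
  Σ ℕ λ a → Σ ℕ λ d → IsKirchBasic a d × InAP a d u ×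
    (∀ (x : ℕ) → InAP a d x → U x)

-- The open set contains a basic progression a + dℕ₀ through u₀, and d is square-free, so p² ∤ d.
-- If p ∤ d, then d is invertible mod pᵏ and the progression meets every residue class mod pᵏ.
-- If d = e p with p ∤ e, then a ≡ u₀ ≡ n (mod p), and a + e p t ≡ n (mod pᵏ) reduces to
-- e t ≡ (n − a)/p (mod pᵏ⁻¹), solvable because e is invertible mod pᵏ⁻¹.
-- Replacing t by t + N pᵏ keeps the residue and exceeds any bound N.
module Submission where

open import Defs
open import Data.Nat using (ℕ; _≤_; _<_; _^_)
open import Data.Nat.Primality using (Prime)
open import Data.Product using (Σ; _×_)

open import Level using (0ℓ)
open import Data.Nat using (zero; suc; _+_; _*_; _∸_; NonZero)
open import Data.Nat.Base using (∣_-_∣; nonTrivial⇒n>1)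
open import Data.Nat.Properties
open import Data.Nat.Divisibility using (_∣_; divides; _∣?_; ∣1⇒≡1; ∣-trans)
open import Data.Nat.Coprimality using (Coprime; coprime-divisor; coprime-Bézout)
open import Data.Nat.GCD using (module Bézout)
open import Data.Nat.Primality using (prime⇒irreducible; prime⇒nonTrivial; prime⇒nonZero)
open import Data.Nat.Tactic.RingSolver using (solve)
open import Data.List using ([]; _∷_)
open import Data.Product using (_,_; ∃; ∃₂; map₂)
open import Data.Sum using (_⊎_; inj₁; inj₂)
open import Data.Empty using (⊥-elim)
open import Relation.Nullary using (yes; no; ¬_)
open import Relation.Binary.Bundles using (Setoid)
open import Relation.Binary.PropositionalEquality
import Relation.Binary.Reasoning.Setoid as SetoidReasoning
open import Algebra.Properties.CommutativeSemigroup *-commutativeSemigroup using (xy∙z≈xz∙y; x∙yz≈yx∙z)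

-- Congruence without truncated subtraction, so that it is closed under + and * directly.
infix 4 _≈_[mod_]

_≈_[mod_] : ℕ → ℕ → ℕ → Set
a ≈ b [mod m ] = ∃₂ λ i j → a + i * m ≡ b + j * m

≈-refl : ∀ {m a} → a ≈ a [mod m ]
≈-refl = 0 , 0 , refl

≈-sym : ∀ {m a b} → a ≈ b [mod m ] → b ≈ a [mod m ]
≈-sym (i , j , eq) = j , i , sym eq

≈-trans : ∀ {m a b c} → a ≈ b [mod m ] → b ≈ c [mod m ] → a ≈ c [mod m ]
≈-trans {m} {a} {b} {c} (i , j , a≡b) (i′ , j′ , b≡c) = i + i′ , j + j′ , (begin
  a + (i + i′) * m     ≡⟨ solve (a ∷ i ∷ i′ ∷ m ∷ []) ⟩
  (a + i * m) + i′ * m ≡⟨ cong (_+ i′ * m) a≡b ⟩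
  (b + j * m) + i′ * m ≡⟨ solve (b ∷ j ∷ i′ ∷ m ∷ []) ⟩
  (b + i′ * m) + j * m ≡⟨ cong (_+ j * m) b≡c ⟩
  (c + j′ * m) + j * m ≡⟨ solve (c ∷ j′ ∷ j ∷ m ∷ []) ⟩
  c + (j + j′) * m     ∎)
  where open ≡-Reasoning

≈-setoid : ℕ → Setoid 0ℓ 0ℓ
≈-setoid m = record
  { Carrier       = ℕ
  ; _≈_           = λ a b → a ≈ b [mod m ]
  ; isEquivalence = record { refl = ≈-refl ; sym = ≈-sym ; trans = ≈-trans }
  }

module ≈-Reasoning (m : ℕ) = SetoidReasoning (≈-setoid m)

≤∧∣-∣≡*⇒≈ : ∀ {m a b} z → a ≤ b → ∣ a - b ∣ ≡ z * m → a ≈ b [mod m ]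
≤∧∣-∣≡*⇒≈ {m} {a} {b} z a≤b ∣a-b∣≡zm = z , 0 , (begin
  a + z * m     ≡⟨ cong (a +_) (sym ∣a-b∣≡zm) ⟩
  a + ∣ a - b ∣ ≡⟨ cong (a +_) (m≤n⇒∣m-n∣≡n∸m a≤b) ⟩
  a + (b ∸ a)   ≡⟨ m+[n∸m]≡n a≤b ⟩
  b             ≡⟨ +-identityʳ b ⟨
  b + 0         ∎)
  where open ≡-Reasoning

≡[mod]⇒≈ : ∀ {m a b} → a ≡ b [mod m ] → a ≈ b [mod m ]
≡[mod]⇒≈ {a = a} {b} (divides z eq) with ≤-total a b
... | inj₁ a≤b = ≤∧∣-∣≡*⇒≈ z a≤b eq
... | inj₂ b≤a = ≈-sym (≤∧∣-∣≡*⇒≈ z b≤a (trans (∣-∣-comm b a) eq))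

≈⇒≡[mod] : ∀ {m a b} → a ≈ b [mod m ] → a ≡ b [mod m ]
≈⇒≡[mod] {m} {a} {b} (i , j , eq) = divides ∣ j - i ∣ (begin
  ∣ a - b ∣                 ≡⟨ ∣m+n-m+o∣≡∣n-o∣ (i * m) a b ⟨
  ∣ i * m + a - i * m + b ∣ ≡⟨ cong₂ ∣_-_∣ (trans (+-comm (i * m) a) eq) (+-comm (i * m) b) ⟩
  ∣ b + j * m - b + i * m ∣ ≡⟨ ∣m+n-m+o∣≡∣n-o∣ b (j * m) (i * m) ⟩
  ∣ j * m - i * m ∣         ≡⟨ *-distribʳ-∣-∣ m j i ⟨
  ∣ j - i ∣ * m             ∎)
  where open ≡-Reasoning

≈-mod-1 : ∀ a b → a ≈ b [mod 1 ]
≈-mod-1 a b = b , a , (begin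
  a + b * 1 ≡⟨ cong (a +_) (*-identityʳ b) ⟩
  a + b     ≡⟨ +-comm a b ⟩
  b + a     ≡⟨ cong (b +_) (*-identityʳ a) ⟨
  b + a * 1 ∎)
  where open ≡-Reasoning

+-multiple-≈ : ∀ {m} a k → a + k * m ≈ a [mod m ]
+-multiple-≈ a k = 0 , k , +-identityʳ _

≈-+ˡ : ∀ {m a b} c → a ≈ b [mod m ] → c + a ≈ c + b [mod m ]
≈-+ˡ {m} {a} {b} c (i , j , eq) = i , j , (begin
  c + a + i * m   ≡⟨ +-assoc c a _ ⟩
  c + (a + i * m) ≡⟨ cong (c +_) eq ⟩
  c + (b + j * m) ≡⟨ +-assoc c b _ ⟨
  c + b + j * m   ∎)
  where open ≡-Reasoning

≈-*ʳ : ∀ {m a b} c → a ≈ b [mod m ] → a * c ≈ b * c [mod m ]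
≈-*ʳ {m} {a} {b} c (i , j , eq) = i * c , j * c , (begin
  a * c + i * c * m   ≡⟨ solve (a ∷ c ∷ i ∷ m ∷ []) ⟩
  (a + i * m) * c     ≡⟨ cong (_* c) eq ⟩
  (b + j * m) * c     ≡⟨ solve (b ∷ c ∷ j ∷ m ∷ []) ⟩
  b * c + j * c * m   ∎)
  where open ≡-Reasoning

≈-scaleˡ : ∀ {m a b} c → a ≈ b [mod m ] → c * a ≈ c * b [mod c * m ]
≈-scaleˡ {m} {a} {b} c (i , j , eq) = i , j , (begin
  c * a + i * (c * m) ≡⟨ solve (a ∷ c ∷ i ∷ m ∷ []) ⟩
  c * (a + i * m)     ≡⟨ cong (c *_) eq ⟩
  c * (b + j * m)     ≡⟨ solve (b ∷ c ∷ j ∷ m ∷ []) ⟩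
  c * b + j * (c * m) ∎)
  where open ≡-Reasoning

coprime⇒invertible : ∀ {e Q} .{{_ : NonZero Q}} → Coprime e Q → ∃ λ x → e * x ≈ 1 [mod Q ]
coprime⇒invertible {e} {suc r} e⊥Q with coprime-Bézout e⊥Q
... | Bézout.+- x y 1+yQ≡xe = x , 0 , y , trans (trans (+-identityʳ (e * x)) (*-comm e x)) (sym 1+yQ≡xe)
... | Bézout.-+ x y 1+xe≡yQ = x * r , y , x * e , (begin
  e * (x * r) + y * suc r   ≡⟨ cong (e * (x * r) +_) 1+xe≡yQ ⟨
  e * (x * r) + (1 + x * e) ≡⟨ solve (e ∷ x ∷ r ∷ []) ⟩
  1 + x * e * suc r         ∎)
  where open ≡-Reasoning

≈-lift : ∀ {m a n} Q .{{_ : NonZero Q}} → a ≈ n [mod m ] → ∃ λ c → a + m * c ≈ n [mod m * Q ]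
≈-lift {m} {a} {n} (suc r) (i , j , a+im≡n+jm) = i + j * r , 0 , j , (begin
  a + m * (i + j * r) + 0 * (m * suc r) ≡⟨ solve (a ∷ m ∷ i ∷ j ∷ r ∷ []) ⟩
  (a + i * m) + j * m * r               ≡⟨ cong (_+ j * m * r) a+im≡n+jm ⟩
  n + j * m + j * m * r                 ≡⟨ solve (n ∷ m ∷ j ∷ r ∷ []) ⟩
  n + j * (m * suc r)                   ∎)
  where open ≡-Reasoning

linear-congruence : ∀ {m a n e} Q .{{_ : NonZero Q}} → Coprime e Q → a ≈ n [mod m ] →
                    ∃ λ t → a + m * (e * t) ≈ n [mod m * Q ]
linear-congruence {m} {a} {n} {e} Q e⊥Q a≈n with ≈-lift Q a≈n | coprime⇒invertible e⊥Q
... | c , a+mc≈n | x , ex≈1 = x * c , a+m[e[xc]]≈n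
  where
  e[xc]≈c : e * (x * c) ≈ c [mod Q ]
  e[xc]≈c = begin
    e * (x * c) ≡⟨ *-assoc e x c ⟨
    e * x * c   ≈⟨ ≈-*ʳ c ex≈1 ⟩
    1 * c       ≡⟨ *-identityˡ c ⟩
    c           ∎
    where open ≈-Reasoning Q

  a+m[e[xc]]≈n : a + m * (e * (x * c)) ≈ n [mod m * Q ]
  a+m[e[xc]]≈n = begin
    a + m * (e * (x * c)) ≈⟨ ≈-+ˡ a (≈-scaleˡ m e[xc]≈c) ⟩
    a + m * c             ≈⟨ a+mc≈n ⟩
    n                     ∎
    where open ≈-Reasoning (m * Q)

coprime-* : ∀ {m n o} → Coprime m n → Coprime m o → Coprime m (n * o)
coprime-* m⊥n m⊥o (i∣m , i∣no) =
  m⊥o (i∣m , coprime-divisor (λ (j∣i , j∣n) → m⊥n (∣-trans j∣i i∣m , j∣n)) i∣no)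

coprime-^ : ∀ {m n} → Coprime m n → ∀ k → Coprime m (n ^ k)
coprime-^ m⊥n zero    (_ , i∣1) = ∣1⇒≡1 i∣1
coprime-^ m⊥n (suc k) = coprime-* m⊥n (coprime-^ m⊥n k)

prime∤⇒coprime : ∀ {p d} → Prime p → ¬ p ∣ d → Coprime d p
prime∤⇒coprime pp p∤d (i∣d , i∣p) with prime⇒irreducible pp i∣p
... | inj₁ i≡1 = i≡1
... | inj₂ refl = ⊥-elim (p∤d i∣d)

squareFree⇒coprime⊎coprime*p : ∀ {p d} → Prime p → SquareFree d →
                               Coprime d p ⊎ ∃ λ e → d ≡ e * p × Coprime e p
squareFree⇒coprime⊎coprime*p {p} {d} pp d-sqf with p ∣? d
... | no p∤d = inj₁ (prime∤⇒coprime pp p∤d)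
... | yes (divides e d≡ep) = inj₂ (e , d≡ep , prime∤⇒coprime pp p∤e)
  where
  p∤e : ¬ p ∣ e
  p∤e (divides s e≡sp) = d-sqf p (nonTrivial⇒n>1 p {{prime⇒nonTrivial pp}})
    (divides s (trans d≡ep (trans (cong (_* p) e≡sp) (*-assoc s p p))))

coprime⇒ap-meets-class : ∀ {a d n Q} .{{_ : NonZero Q}} → Coprime d Q → ∃ λ t → a + d * t ≈ n [mod Q ]
coprime⇒ap-meets-class {a} {d} {n} {Q} d⊥Q =
  map₂ (λ {t} → subst₂ (λ u q → u ≈ n [mod q ]) (cong (a +_) (*-identityˡ (d * t))) (*-identityˡ Q))
       (linear-congruence Q d⊥Q (≈-mod-1 a n))

ap-meets-class-mod-prime^ : ∀ {p a e n t₀} .{{_ : NonZero p}} → Coprime e p → a + e * p * t₀ ≈ n [mod p ] →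
                            ∀ k → ∃ λ t → a + e * p * t ≈ n [mod p ^ suc k ]
ap-meets-class-mod-prime^ {p} {a} {e} {n} {t₀} e⊥p a+ept₀≈n k =
  map₂ (λ {t} → subst (_≈ n [mod p ^ suc k ]) (cong (a +_) (x∙yz≈yx∙z p e t)))
       (linear-congruence (p ^ k) {{m^n≢0 p k}} (coprime-^ e⊥p k) (≈-trans (≈-sym a+ept₀≈a) a+ept₀≈n))
  where
  a+ept₀≈a : a + e * p * t₀ ≈ a [mod p ]
  a+ept₀≈a = begin
    a + e * p * t₀ ≡⟨ cong (a +_) (xy∙z≈xz∙y e p t₀) ⟩
    a + e * t₀ * p ≈⟨ +-multiple-≈ a (e * t₀) ⟩
    a              ∎
    where open ≈-Reasoning p

squareFree⇒ap-meets-class-mod-prime^ : ∀ {p a d n t₀} → Prime p → SquareFree d → a + d * t₀ ≈ n [mod p ] →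
                                       ∀ k → ∃ λ t → a + d * t ≈ n [mod p ^ k ]
squareFree⇒ap-meets-class-mod-prime^ _ _ _ zero = 0 , ≈-mod-1 _ _
squareFree⇒ap-meets-class-mod-prime^ {p} pp d-sqf a+dt₀≈n (suc k) with squareFree⇒coprime⊎coprime*p pp d-sqf
... | inj₁ d⊥p              = coprime⇒ap-meets-class {{m^n≢0 p (suc k) {{prime⇒nonZero pp}}}} (coprime-^ d⊥p (suc k))
... | inj₂ (e , refl , e⊥p) = ap-meets-class-mod-prime^ {{prime⇒nonZero pp}} e⊥p a+dt₀≈n k

ap-shift-≈ : ∀ a d t N q → a + d * (t + N * q) ≈ a + d * t [mod q ]
ap-shift-≈ a d t N q = 0 , d * N , solve (a ∷ d ∷ t ∷ N ∷ q ∷ [])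

N<ap-shift : ∀ {a d q} t N → 1 ≤ a → 1 ≤ d → 1 ≤ q → N < a + d * (t + N * q)
N<ap-shift {a} {d} {q} t N a≥1 d≥1 q≥1 = +-mono-≤ a≥1 (begin
  N               ≡⟨ *-identityʳ N ⟨
  N * 1           ≤⟨ *-monoʳ-≤ N q≥1 ⟩
  N * q           ≤⟨ m≤n+m (N * q) t ⟩
  t + N * q       ≡⟨ *-identityˡ _ ⟨
  1 * (t + N * q) ≤⟨ *-monoˡ-≤ (t + N * q) d≥1 ⟩
  d * (t + N * q) ∎)
  where open ≤-Reasoning

mainTheorem3 : (U : ℕ → Set) → KirchOpen U → (n : ℕ) → 1 ≤ n → (p : ℕ) → Prime p →
    Σ ℕ (λ u → 1 ≤ u × U u × u ≡ n [mod p ]) →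
    (k : ℕ) → 1 ≤ k → (N : ℕ) → Σ ℕ (λ u → N < u × U u × u ≡ n [mod p ^ k ])
mainTheorem3 U U-open n _ p pp (u₀ , u₀≥1 , u₀∈U , u₀≡n) k _ N
  with U-open u₀ u₀≥1 u₀∈U
... | a , d , (a≥1 , d≥1 , _ , d-sqf) , (t₀ , u₀≡a+dt₀) , ap⊆U
  with squareFree⇒ap-meets-class-mod-prime^ pp d-sqf (subst (_≈ n [mod p ]) u₀≡a+dt₀ (≡[mod]⇒≈ u₀≡n)) k
... | t , a+dt≈n =
  a + d * (t + N * p ^ k) ,
  N<ap-shift t N a≥1 d≥1 (m^n>0 p {{prime⇒nonZero pp}} k) ,
  ap⊆U _ (t + N * p ^ k , refl) ,
  ≈⇒≡[mod] (≈-trans (ap-shift-≈ a d t N (p ^ k)) a+dt≈n)
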